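{- Let $G$ be an abelian group and let $\pi=\{C_1,\dots,C_\ell\}$ be a collection of $\ell$ distinct subsets of $G$, each of size $k$ and containing the identity, pairwise intersecting exactly in the identity and satisfying the $T$-axiom, such that $X=\mathrm{BCay}(G,\pi)$ is $\beta$-transitive. If $\ell\ge 3$, then $X$ has girth six.
   Context: For $C\subseteq G$ and $g\in G$, $gC=\{gs:s\in C\}$. A collection $\pi$ of subsets of $G$, each containing $e$, satisfies the $T$-axiom if for every $C\in\pi$ and $s\in C$, $s^{ -1}C\in\pi$. The Cayley incidence graph $\mathrm{BCay}(G,\pi)$ is the bipartite graph with parts $\gamma=G$ and $\beta=\{gC:g\in G,C\in\pi\}$ (a set of subsets), with $g$ adjacent to $gC$ for every $g\in G$, $C\in\pi$ (equivalently $g$ adjacent to $D\in\beta$ iff $g\in D$). It is $\beta$-transitive if for every $C_i,C_j\in\pi$ there is $s\in C_i$ with $s^{ -1}C_i=C_j$. -}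

module Defs where

open import Level using (Level; _⊔_)
open import Data.Nat using (ℕ; zero; suc; _≤_)
open import Data.Fin using (Fin; zero; suc; inject₁; fromℕ)
open import Data.Product using (Σ; ∃; ∃-syntax; _×_; _,_)
open import Data.List using (List; length)
open import Relation.Binary.PropositionalEquality using (_≡_; _≢_)
open import Relation.Nullary using (¬_)
open import Algebra.Bundles using (AbelianGroup)
import Data.List.Membership.Setoid as MemS
import Data.List.Relation.Unary.Unique.Setoid as UniqS

module Incidence {p b q₁ q₂ i : Level}
  (P : Set p) (_≈P_ : P → P → Set q₁)
  (Bl : Set b) (_≈B_ : Bl → Bl → Set q₂)
  (_I_ : P → Bl → Set i) where

  -- A cycle of length 2 (suc n) in the bipartite graph:
  --   pt 0 - bl 0 - pt 1 - bl 1 - ... - pt n - bl n - pt 0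
  -- with pairwise distinct points and pairwise distinct blocks.
  record Cycle (n : ℕ) : Set (p ⊔ b ⊔ q₁ ⊔ q₂ ⊔ i) where
    field
      pt     : Fin (suc n) → P
      bl     : Fin (suc n) → Bl
      pt-inj : ∀ j k → pt j ≈P pt k → j ≡ k
      bl-inj : ∀ j k → bl j ≈B bl k → j ≡ k
      inc    : ∀ j → pt j I bl j
      inc'   : ∀ (j : Fin n) → pt (suc j) I bl (inject₁ j)
      close  : pt zero I bl (fromℕ n)

  -- Girth six: there is a cycle of length 6 (n = 2), and every cycle
  -- (length 2 (suc n) with n ≥ 1, i.e. length ≥ 4) has length ≥ 6.
  GirthSix : Set (p ⊔ b ⊔ q₁ ⊔ q₂ ⊔ i)
  GirthSix = Cycle 2 × (∀ n → 1 ≤ n → Cycle n → 2 ≤ n)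

-- Cayley incidence structure over an abelian group.
-- Finite subsets of G are lists (duplicate-free when required);
-- membership is up to the group's setoid equality.
module BCay {c r : Level} (G : AbelianGroup c r) where
  open AbelianGroup G public
  open MemS setoid public using (_∈_)
  open UniqS setoid public using (Unique)

  InTrans : Carrier → List Carrier → Carrier → Set (c ⊔ r)
  InTrans g C x = ∃[ s ] (s ∈ C × x ≈ g ∙ s)

  _≐_ : (Carrier → Set (c ⊔ r)) → (Carrier → Set (c ⊔ r)) → Set (c ⊔ r)
  A ≐ B = ∀ x → (A x → B x) × (B x → A x)

  module _ {l : ℕ} (C : Fin l → List Carrier) where

    InList : List Carrier → Carrier → Set (c ⊔ r)
    InList D x = x ∈ D

    TAxiom : Set (c ⊔ r)
    TAxiom = ∀ j s → s ∈ C j → ∃[ k ] (InTrans (s ⁻¹) (C j) ≐ InList (C k))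

    BetaTransitive : Set (c ⊔ r)
    BetaTransitive = ∀ j k → ∃[ s ] (s ∈ C j × (InTrans (s ⁻¹) (C j) ≐ InList (C k)))

    -- blocks gC, represented by pairs (g , i); equality = equality as sets
    Block : Set c
    Block = Carrier × Fin l

    _≈Bl_ : Block → Block → Set (c ⊔ r)
    (g , j) ≈Bl (h , k) = InTrans g (C j) ≐ InTrans h (C k)

    _Inc_ : Carrier → Block → Set (c ⊔ r)
    x Inc (g , j) = InTrans g (C j) x

    open Incidence Carrier _≈_ Block _≈Bl_ _Inc_ public

module Submission where

open import Level using (_⊔_)
open import Defs
open import Data.Nat using (ℕ; zero; suc; _≤_; s≤s; z≤n)
open import Data.Fin using (Fin; zero; suc; _≟_)
open import Data.Product using (_×_; _,_; proj₁; proj₂; ∃-syntax)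
open import Data.List using (List; length)
open import Data.Empty using (⊥; ⊥-elim)
open import Relation.Binary.PropositionalEquality using (_≡_; _≢_)
import Relation.Binary.PropositionalEquality as ≡
open import Relation.Nullary using (¬_; yes; no; contradiction)
open import Function using (_∘_)
open import Algebra.Bundles using (AbelianGroup)
import Algebra.Properties.Group as GroupProperties
open import Data.List.Membership.Setoid.Properties using (∈-resp-≈)

-- By the T-axiom every block through a point x is a translate x Cₚ.  Two
-- blocks through x are therefore x Cₚ and x C_q: if p = q they coincide, and
-- otherwise they meet only in x, since Cₚ ∩ C_q = {e}.  So there is no 4-cycle.
-- For a 6-cycle, β-transitivity gives s, t ∈ C₀ with s⁻¹C₀ = C₁ and
-- t⁻¹C₀ = C₂; then e, s⁻¹, t⁻¹ lie on C₁, s⁻¹t⁻¹C₀, C₂ cyclically, since in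
-- an abelian group s⁻¹ = (s⁻¹t⁻¹) t and t⁻¹ = (s⁻¹t⁻¹) s.

pairwise-unrelated₃⇒≡ : ∀ {a} {R : Fin 3 → Fin 3 → Set a} → (∀ {j k} → R j k → R k j) →
  ¬ R zero (suc zero) → ¬ R zero (suc (suc zero)) → ¬ R (suc zero) (suc (suc zero)) →
  ∀ j k → R j k → j ≡ k
pairwise-unrelated₃⇒≡ R-sym ¬R01 ¬R02 ¬R12 = λ where
  zero             zero             _ → ≡.refl
  zero             (suc zero)       r → contradiction r ¬R01
  zero             (suc (suc zero)) r → contradiction r ¬R02
  (suc zero)       zero             r → contradiction (R-sym r) ¬R01
  (suc zero)       (suc zero)       _ → ≡.refl
  (suc zero)       (suc (suc zero)) r → contradiction r ¬R12
  (suc (suc zero)) zero             r → contradiction (R-sym r) ¬R02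
  (suc (suc zero)) (suc zero)       r → contradiction (R-sym r) ¬R12
  (suc (suc zero)) (suc (suc zero)) _ → ≡.refl

module CayleyIncidence {c r} (G : AbelianGroup c r) where
  open BCay G
  open GroupProperties group using (\\-leftDividesˡ; //-rightDividesˡ; ∙-cancelˡ)
  open import Relation.Binary.Reasoning.Setoid setoid

  ≐-sym : ∀ {A B} → A ≐ B → B ≐ A
  ≐-sym A≐B x = proj₂ (A≐B x) , proj₁ (A≐B x)

  ≐-trans : ∀ {A B D} → A ≐ B → B ≐ D → A ≐ D
  ≐-trans A≐B B≐D x = (λ a → proj₁ (B≐D x) (proj₁ (A≐B x) a))
                    , (λ d → proj₂ (A≐B x) (proj₂ (B≐D x) d))

  translate-cong : ∀ {g h} D → g ≈ h → InTrans g D ≐ InTrans h D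
  translate-cong D g≈h x = (λ (s , s∈D , x≈gs) → s , s∈D , trans x≈gs (∙-congʳ g≈h))
                         , (λ (s , s∈D , x≈hs) → s , s∈D , trans x≈hs (∙-congʳ (sym g≈h)))

  translate-identity : ∀ D → InTrans ε D ≐ (_∈ D)
  translate-identity D x = (λ (s , s∈D , x≈εs) → ∈-resp-≈ setoid (sym (trans x≈εs (identityˡ s))) s∈D)
                         , (λ x∈D → x , x∈D , sym (identityˡ x))

  translate-∋ : ∀ {g D E} → ε ∈ D → InTrans g D ≐ (_∈ E) → g ∈ E
  translate-∋ {g} ε∈D gD≐E = proj₁ (gD≐E g) (ε , ε∈D , sym (identityʳ g))

  translate-≉ε : ∀ {g D E} → InTrans g D ≐ (_∈ E) → ¬ ((_∈ D) ≐ (_∈ E)) → ¬ (g ≈ ε)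
  translate-≉ε {D = D} gD≐E D≉E g≈ε =
    D≉E (≐-trans (≐-sym (translate-identity D))
                 (≐-trans (translate-cong D (sym g≈ε)) gD≐E))

  recentre-translate : ∀ {D E} g a → InTrans (a ⁻¹) D ≐ (_∈ E) →
                       InTrans g D ≐ InTrans (g ∙ a) E
  recentre-translate g a a⁻¹D≐E x =
    (λ (d , d∈D , x≈gd) →
       a ⁻¹ ∙ d , proj₁ (a⁻¹D≐E _) (d , d∈D , refl) , trans x≈gd (shift d)) ,
    (λ (e , e∈E , x≈gae) →
       let d , d∈D , e≈a⁻¹d = proj₂ (a⁻¹D≐E e) e∈E in
       d , d∈D , (begin
         x                     ≈⟨ x≈gae ⟩
         (g ∙ a) ∙ e           ≈⟨ ∙-congˡ e≈a⁻¹d ⟩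
         (g ∙ a) ∙ (a ⁻¹ ∙ d)  ≈⟨ shift d ⟨
         g ∙ d                 ∎))
    where
    shift : ∀ d → g ∙ d ≈ (g ∙ a) ∙ (a ⁻¹ ∙ d)
    shift d = begin
      g ∙ d                 ≈⟨ ∙-congˡ (\\-leftDividesˡ a d) ⟨
      g ∙ (a ∙ (a ⁻¹ ∙ d))  ≈⟨ assoc g a _ ⟨
      (g ∙ a) ∙ (a ⁻¹ ∙ d)  ∎

  inverses∈translate : ∀ {s t D} → s ∈ D → t ∈ D →
    InTrans (s ⁻¹ ∙ t ⁻¹) D (s ⁻¹) × InTrans (s ⁻¹ ∙ t ⁻¹) D (t ⁻¹)
  inverses∈translate {s} {t} s∈D t∈D =
    (t , t∈D , sym (//-rightDividesˡ t (s ⁻¹))) ,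
    (s , s∈D , trans (sym (//-rightDividesˡ s (t ⁻¹))) (∙-congʳ (comm (t ⁻¹) (s ⁻¹))))

  module _ {l : ℕ} (C : Fin l → List Carrier) where

    PairwiseDistinct : Set (c ⊔ r)
    PairwiseDistinct = ∀ i j → i ≢ j → ¬ (InList C (C i) ≐ InList C (C j))

    PairwiseMeetInIdentity : Set (c ⊔ r)
    PairwiseMeetInIdentity = ∀ i j → i ≢ j → ∀ x → x ∈ C i → x ∈ C j → x ≈ ε

    block-centred-at : TAxiom C → ∀ {x} B → _Inc_ C x B → ∃[ p ] _≈Bl_ C B (x , p)
    block-centred-at T {x} (g , i) (a , a∈Cᵢ , x≈ga) =
      let p , a⁻¹Cᵢ≐Cₚ = T i a a∈Cᵢ in
      p , ≐-trans (recentre-translate g a a⁻¹Cᵢ≐Cₚ) (translate-cong (C p) (sym x≈ga))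

    centred-blocks-meet-at-centre : PairwiseMeetInIdentity → ∀ {p q x y} → p ≢ q →
      _Inc_ C y (x , p) → _Inc_ C y (x , q) → y ≈ x
    centred-blocks-meet-at-centre meet {p} {q} {x} {y} p≢q (u , u∈Cₚ , y≈xu) (v , v∈C_q , y≈xv) =
      begin
        y      ≈⟨ y≈xu ⟩
        x ∙ u  ≈⟨ ∙-congˡ (meet p q p≢q u u∈Cₚ (∈-resp-≈ setoid (sym u≈v) v∈C_q)) ⟩
        x ∙ ε  ≈⟨ identityʳ x ⟩
        x      ∎
      where
      u≈v : u ≈ v
      u≈v = ∙-cancelˡ x u v (trans (sym y≈xu) y≈xv)

    no-4-cycle : PairwiseMeetInIdentity → TAxiom C → ¬ Cycle C 1
    no-4-cycle meet T cyc =
      compare (block-centred-at T (bl zero) (inc zero)) (block-centred-at T (bl (suc zero)) close)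
      where
      open Cycle C cyc
      compare : ∃[ p ] _≈Bl_ C (bl zero) (pt zero , p) →
                ∃[ q ] _≈Bl_ C (bl (suc zero)) (pt zero , q) → ⊥
      compare (p , bl₀≐xCₚ) (q , bl₁≐xC_q) with p ≟ q
      ... | yes ≡.refl = contradiction (bl-inj zero (suc zero) (≐-trans bl₀≐xCₚ (≐-sym bl₁≐xC_q))) λ ()
      ... | no p≢q = contradiction
        (pt-inj (suc zero) zero (centred-blocks-meet-at-centre meet p≢q
          (proj₁ (bl₀≐xCₚ _) (inc' zero)) (proj₁ (bl₁≐xC_q _) (inc (suc zero)))))
        λ ()

    six-cycle : (∀ i → ε ∈ C i) → PairwiseDistinct → PairwiseMeetInIdentity → BetaTransitive C →
      ∀ {i₀ i₁ i₂} → i₀ ≢ i₁ → i₀ ≢ i₂ → i₁ ≢ i₂ → Cycle C 2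
    six-cycle ε∈C distinct meet β {i₀} {i₁} {i₂} i₀≢i₁ i₀≢i₂ i₁≢i₂ = record
      { pt     = pt
      ; bl     = bl
      ; pt-inj = pairwise-unrelated₃⇒≡ sym (s⁻¹≉ε ∘ sym) (t⁻¹≉ε ∘ sym) s⁻¹≉t⁻¹
      ; bl-inj = pairwise-unrelated₃⇒≡ ≐-sym C₁≉mid C₁≉C₂ mid≉C₂
      ; inc    = λ { zero → on-C (ε∈C i₁) ; (suc zero) → s⁻¹∈mid ; (suc (suc zero)) → on-C t⁻¹∈C₂ }
      ; inc'   = λ { zero → on-C s⁻¹∈C₁ ; (suc zero) → t⁻¹∈mid }
      ; close  = on-C (ε∈C i₂)
      }
      where
      s t : Carrier
      s = proj₁ (β i₀ i₁)
      t = proj₁ (β i₀ i₂)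
      s∈C₀ : s ∈ C i₀
      s∈C₀ = proj₁ (proj₂ (β i₀ i₁))
      t∈C₀ : t ∈ C i₀
      t∈C₀ = proj₁ (proj₂ (β i₀ i₂))
      s⁻¹C₀≐C₁ : InTrans (s ⁻¹) (C i₀) ≐ (_∈ C i₁)
      s⁻¹C₀≐C₁ = proj₂ (proj₂ (β i₀ i₁))
      t⁻¹C₀≐C₂ : InTrans (t ⁻¹) (C i₀) ≐ (_∈ C i₂)
      t⁻¹C₀≐C₂ = proj₂ (proj₂ (β i₀ i₂))
      s⁻¹∈C₁ : s ⁻¹ ∈ C i₁
      s⁻¹∈C₁ = translate-∋ (ε∈C i₀) s⁻¹C₀≐C₁
      t⁻¹∈C₂ : t ⁻¹ ∈ C i₂
      t⁻¹∈C₂ = translate-∋ (ε∈C i₀) t⁻¹C₀≐C₂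
      s⁻¹≉ε : ¬ (s ⁻¹ ≈ ε)
      s⁻¹≉ε = translate-≉ε s⁻¹C₀≐C₁ (distinct i₀ i₁ i₀≢i₁)
      t⁻¹≉ε : ¬ (t ⁻¹ ≈ ε)
      t⁻¹≉ε = translate-≉ε t⁻¹C₀≐C₂ (distinct i₀ i₂ i₀≢i₂)

      pt : Fin 3 → Carrier
      pt zero             = ε
      pt (suc zero)       = s ⁻¹
      pt (suc (suc zero)) = t ⁻¹

      bl : Fin 3 → Block C
      bl zero             = ε , i₁
      bl (suc zero)       = s ⁻¹ ∙ t ⁻¹ , i₀
      bl (suc (suc zero)) = ε , i₂

      on-C : ∀ {x i} → x ∈ C i → _Inc_ C x (ε , i)
      on-C {x} {i} = proj₂ (translate-identity (C i) x)

      from-C : ∀ {x i} → _Inc_ C x (ε , i) → x ∈ C i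
      from-C {x} {i} = proj₁ (translate-identity (C i) x)

      s⁻¹∈mid : _Inc_ C (s ⁻¹) (bl (suc zero))
      s⁻¹∈mid = proj₁ (inverses∈translate s∈C₀ t∈C₀)

      t⁻¹∈mid : _Inc_ C (t ⁻¹) (bl (suc zero))
      t⁻¹∈mid = proj₂ (inverses∈translate s∈C₀ t∈C₀)

      s⁻¹≉t⁻¹ : ¬ (s ⁻¹ ≈ t ⁻¹)
      s⁻¹≉t⁻¹ e = s⁻¹≉ε (meet i₁ i₂ i₁≢i₂ _ s⁻¹∈C₁ (∈-resp-≈ setoid (sym e) t⁻¹∈C₂))

      C₁≉mid : ¬ _≈Bl_ C (bl zero) (bl (suc zero))
      C₁≉mid e = t⁻¹≉ε (meet i₁ i₂ i₁≢i₂ _ (from-C (proj₂ (e _) t⁻¹∈mid)) t⁻¹∈C₂)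

      C₁≉C₂ : ¬ _≈Bl_ C (bl zero) (bl (suc (suc zero)))
      C₁≉C₂ e = distinct i₁ i₂ i₁≢i₂ λ x → (λ m → from-C (proj₁ (e x) (on-C m)))
                                         , (λ m → from-C (proj₂ (e x) (on-C m)))

      mid≉C₂ : ¬ _≈Bl_ C (bl (suc zero)) (bl (suc (suc zero)))
      mid≉C₂ e = s⁻¹≉ε (meet i₁ i₂ i₁≢i₂ _ s⁻¹∈C₁ (from-C (proj₁ (e _) s⁻¹∈mid)))

open CayleyIncidence

lemma6p11 : ∀ {c r} (G : AbelianGroup c r) →
    let open BCay G in
    (k l : ℕ) (C : Fin l → List Carrier) →
    (∀ i → Unique (C i)) →
    (∀ i → length (C i) ≡ k) →
    (∀ i → ε ∈ C i) →
    (∀ i j → i ≢ j → ¬ (InList C (C i) ≐ InList C (C j))) →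
    (∀ i j → i ≢ j → ∀ x → x ∈ C i → x ∈ C j → x ≈ ε) →
    TAxiom C →
    BetaTransitive C →
    3 ≤ l →
    GirthSix C
lemma6p11 G _ (suc (suc (suc _))) C _ _ ε∈C distinct meet T β (s≤s (s≤s (s≤s _))) =
  six-cycle G C ε∈C distinct meet β {zero} {suc zero} {suc (suc zero)} (λ ()) (λ ()) (λ ()) ,
  λ { zero () _
    ; (suc zero) _ cycle₄ → ⊥-elim (no-4-cycle G C meet T cycle₄)
    ; (suc (suc _)) _ _ → s≤s (s≤s z≤n) }
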